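{- Let $\lambda$ be a self-conjugate $6$-core partition with abacus $(0,a,b,c,d,e)$, let $s=a+b+c+d+e$ (the number of parts of $\lambda$), and let $r\in\mathbb{N}_0$. (1) If $s=6r$, then $e=2r$, $a+d=2r$, $b+c=2r$. (2) If $s=6r+1$, then $a=2r+1$, $b+e=2r$, $c+d=2r$. (3) If $s=6r+2$, then $a+b=2r+1$, $c=2r+1$, $d+e=2r$. (4) If $s=6r+3$, then $b+c=2r+1$, $a+d=2r+1$, $e=2r+1$. (5) If $s=6r+4$, then $c+d=2r+1$, $b+e=2r+1$, $a=2r+2$. (6) If $s=6r+5$, then $d+e=2r+1$, $a+b=2r+2$, $c=2r+2$.
   Context: For a partition $\lambda=(\lambda_1\ge\dots\ge\lambda_s>0)$ with $s$ parts, the structure numbers are $B_j=\lambda_j-j+s$ ($1\le j\le s$), which are distinct positive integers. The $t$-abacus of $\lambda$ records, for each residue $c\in\{0,\dots,t-1\}$, the number $m_c$ of structure numbers congruent to $c$ modulo $t$; for a $t$-core, the structure numbers congruent to $c$ are exactly $c, c+t,\dots,c+(m_c-1)t$ (for $c\ge1$), and $m_0=0$, so the $t$-core is encoded by the tuple $(0,m_1,\dots,m_{t-1})$, which determines it uniquely. A partition is a $t$-core if no hook length is divisible by $t$; it is self-conjugate if it equals its conjugate. -}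

module Defs where

import Data.Nat
open import Data.Nat using (ℕ; zero; suc; _+_; _∸_; _≤_; _<_; _≤?_; _≟_)
open import Data.Nat.DivMod using (_%_)
open import Data.Nat.Divisibility using (_∣_)
open import Data.List using (List; []; _∷_; length; map; filter; upTo)
open import Data.Product using (_×_)
open import Data.Unit using (⊤)
open import Relation.Nullary using (¬_)
open import Relation.Binary.PropositionalEquality using (_≡_)

Decreasing : List ℕ → Set
Decreasing []           = ⊤
Decreasing (x ∷ [])     = ⊤
Decreasing (x ∷ y ∷ xs) = (y ≤ x) × Decreasing (y ∷ xs)

AllPositive : List ℕ → Set
AllPositive []       = ⊤
AllPositive (x ∷ xs) = (0 < x) × AllPositive xs

IsPartition : List ℕ → Set
IsPartition la = Decreasing la × AllPositive la

-- part la i = λ_{i+1} (0-indexed), and 0 beyond the last part.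
part : List ℕ → ℕ → ℕ
part []       _       = 0
part (x ∷ xs) zero    = x
part (x ∷ xs) (suc i) = part xs i

conj : List ℕ → List ℕ
conj la = map (λ i → length (filter (λ x → suc i ≤? x) la)) (upTo (part la 0))

SelfConjugate : List ℕ → Set
SelfConjugate la = conj la ≡ la

-- hook length of the cell in row i, column j (both 0-indexed),
-- valid when j < λ_{i+1}: arm + leg + 1 = (λ_i - j) + (λ'_j - i) - 1
hook : List ℕ → ℕ → ℕ → ℕ
hook la i j = ((part la i ∸ j) + (part (conj la) j ∸ i)) ∸ 1

IsCore : ℕ → List ℕ → Set
IsCore t la = ∀ i j → j < part la i → ¬ (t ∣ hook la i j)

-- structure numbers B_j = λ_j - j + s, j = 1 … s  (here k = j - 1)
structureNumbers : List ℕ → List ℕ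
structureNumbers la = map (λ k → part la k + (length la ∸ suc k)) (upTo (length la))

abacusCount : (t : ℕ) → .{{_ : Data.Nat.NonZero t}} → List ℕ → ℕ → ℕ
abacusCount t la c = length (filter (λ x → x % t ≟ c) (structureNumbers la))

-- For a self-conjugate partition λ with s parts (so λ₁ = s), the structure numbers
-- B_i = λ_{i+1} + s − i − 1 and their reflections 2s − 1 − B_i together run through
-- 0, …, 2s − 1 exactly once: they label the vertical and the horizontal steps of the
-- boundary of the Young diagram inside the s × s box.  Hence whenever
-- c + c' + 1 ≡ 2s (mod t), the abacus counts satisfy m_c + m_{c'} = #{x < 2s : x ≡ c},
-- which is 2n + #{x < 2q : x ≡ c} for s = nt + q.  For t = 6 and m₀ = 0 the six cases
-- are these relations for the appropriate pairs (c, c').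
module Submission where

open import Defs
open import Data.Bool using (true; false; if_then_else_)
open import Data.Fin using (Fin; toℕ; #_)
open import Data.Fin.Properties using (toℕ<n)
open import Data.List using (List; []; _∷_; length; map; filter; upTo; applyUpTo)
open import Data.List.Properties using (filter-accept; filter-reject; map-upTo; length-map; length-upTo)
open import Data.Nat
open import Data.Nat.DivMod
open import Data.Nat.Divisibility using (∣-refl; n∣m*n)
open import Data.Nat.Properties
open import Data.Nat.Tactic.RingSolver using (solve-∀)
open import Data.Product using (_×_; _,_; proj₁)
open import Function using (_⇔_; mk⇔; Equivalence)
open import Relation.Nullary using (Dec; yes; no; does; contradiction)
open import Relation.Unary using (Pred; Decidable)
open import Relation.Binary.PropositionalEquality
open ≡-Reasoning
open import Algebra.Properties.CommutativeSemigroup +-commutativeSemigroup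
  using (interchange; x∙yz≈y∙xz; xy∙z≈xz∙y)

∑ : ℕ → (ℕ → ℕ) → ℕ
∑ zero    f = 0
∑ (suc n) f = f 0 + ∑ n (λ k → f (suc k))

syntax ∑ n (λ k → e) = ∑[ k < n ] e

∑-cong : ∀ n {f g : ℕ → ℕ} → (∀ k → k < n → f k ≡ g k) → ∑ n f ≡ ∑ n g
∑-cong zero    eq = refl
∑-cong (suc n) eq = cong₂ _+_ (eq 0 z<s) (∑-cong n (λ k k<n → eq (suc k) (s<s k<n)))

∑-+ : ∀ m n (f : ℕ → ℕ) → ∑ (m + n) f ≡ ∑ m f + ∑[ k < n ] f (m + k)
∑-+ zero    n f = refl
∑-+ (suc m) n f = trans (cong (f 0 +_) (∑-+ m n (λ k → f (suc k)))) (sym (+-assoc (f 0) _ _))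

∑-suc : ∀ n (f : ℕ → ℕ) → ∑ (suc n) f ≡ ∑ n f + f n
∑-suc n f = begin
  ∑ (suc n) f                   ≡⟨ cong (λ m → ∑ m f) (+-comm 1 n) ⟩
  ∑ (n + 1) f                   ≡⟨ ∑-+ n 1 f ⟩
  ∑ n f + (f (n + 0) + 0)       ≡⟨ cong (∑ n f +_) (trans (+-identityʳ _) (cong f (+-identityʳ n))) ⟩
  ∑ n f + f n                   ∎

∑-distrib-+ : ∀ n (f g : ℕ → ℕ) → ∑[ k < n ] (f k + g k) ≡ ∑ n f + ∑ n g
∑-distrib-+ zero    f g = refl
∑-distrib-+ (suc n) f g = begin
  (f 0 + g 0) + ∑[ k < n ] (f (suc k) + g (suc k)) ≡⟨ cong ((f 0 + g 0) +_) (∑-distrib-+ n _ _) ⟩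
  (f 0 + g 0) + (F + G)                            ≡⟨ interchange (f 0) (g 0) F G ⟩
  (f 0 + F) + (g 0 + G)                            ∎
  where
  F = ∑[ k < n ] f (suc k)
  G = ∑[ k < n ] g (suc k)

∑-const : ∀ n m → ∑[ _ < n ] m ≡ n * m
∑-const zero    m = refl
∑-const (suc n) m = cong (m +_) (∑-const n m)

∑-periodic : ∀ t n m (f : ℕ → ℕ) → (∀ x → f (t + x) ≡ f x) → ∑ (n * t + m) f ≡ n * ∑ t f + ∑ m f
∑-periodic t zero    m f per = refl
∑-periodic t (suc n) m f per = begin
  ∑ (t + n * t + m) f                        ≡⟨ cong (λ l → ∑ l f) (+-assoc t (n * t) m) ⟩
  ∑ (t + (n * t + m)) f                      ≡⟨ ∑-+ t (n * t + m) f ⟩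
  ∑ t f + ∑[ x < n * t + m ] f (t + x)       ≡⟨ cong (∑ t f +_) (∑-cong (n * t + m) (λ x _ → per x)) ⟩
  ∑ t f + ∑ (n * t + m) f                    ≡⟨ cong (∑ t f +_) (∑-periodic t n m f per) ⟩
  ∑ t f + (n * ∑ t f + ∑ m f)                ≡⟨ sym (+-assoc (∑ t f) _ _) ⟩
  ∑ t f + n * ∑ t f + ∑ m f                  ∎

indicator : ∀ {a} {A : Set a} → Dec A → ℕ
indicator d = if does d then 1 else 0

indicator-cong : ∀ {a b} {A : Set a} {B : Set b} → A ⇔ B → (p : Dec A) (q : Dec B) → indicator p ≡ indicator q
indicator-cong A⇔B (yes _) (yes _) = refl
indicator-cong A⇔B (no _)  (no _)  = refl
indicator-cong A⇔B (yes a) (no ¬b) = contradiction (Equivalence.to A⇔B a) ¬b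
indicator-cong A⇔B (no ¬a) (yes b) = contradiction (Equivalence.from A⇔B b) ¬a

∑-indicator-≟ : ∀ {n c} → c < n → ∑[ k < n ] indicator (k ≟ c) ≡ 1
∑-indicator-≟ {suc n} {zero}  _         = cong suc (trans (∑-const n 0) (*-zeroʳ n))
∑-indicator-≟ {suc n} {suc c} (s≤s c<n) = ∑-indicator-≟ c<n

module _ {n : ℕ} .{{_ : NonZero n}} where

  %-congˡ-+ : ∀ {m p} o → m % n ≡ p % n → (m + o) % n ≡ (p + o) % n
  %-congˡ-+ {m} {p} o eq = begin
    (m + o) % n             ≡⟨ %-distribˡ-+ m o n ⟩
    (m % n + o % n) % n     ≡⟨ cong (λ r → (r + o % n) % n) eq ⟩
    (p % n + o % n) % n     ≡⟨ %-distribˡ-+ p o n ⟨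
    (p + o) % n             ∎

  %-cancelʳ-+ : ∀ {m p} o → (m + o) % n ≡ (p + o) % n → m % n ≡ p % n
  %-cancelʳ-+ {m} {p} o eq = begin
    m % n                       ≡⟨ [m+kn]%n≡m%n m o n ⟨
    (m + o * n) % n             ≡⟨ cong (_% n) (split m) ⟩
    (m + o + (o * n ∸ o)) % n   ≡⟨ %-congˡ-+ (o * n ∸ o) eq ⟩
    (p + o + (o * n ∸ o)) % n   ≡⟨ cong (_% n) (split p) ⟨
    (p + o * n) % n             ≡⟨ [m+kn]%n≡m%n p o n ⟩
    p % n                       ∎
    where
    split : ∀ m → m + o * n ≡ m + o + (o * n ∸ o)
    split m = trans (cong (m +_) (sym (m+[n∸m]≡n (m≤m*n o n)))) (sym (+-assoc m o _))

  residue-reflect : ∀ {x y c c' N} → x + y + 1 ≡ N → (c + c' + 1) % n ≡ N % n → c' < n →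
                    x % n ≡ c → y % n ≡ c'
  residue-reflect {x} {y} {c} {c'} {N} x+y+1≡N c+c'+1≡N c'<n x≡c = begin
    y % n    ≡⟨ %-cancelʳ-+ (c + 1) y+c+1≡c'+c+1 ⟩
    c' % n   ≡⟨ m<n⇒m%n≡m c'<n ⟩
    c'       ∎
    where
    c≡x : c % n ≡ x % n
    c≡x = trans (cong (_% n) (sym x≡c)) (m%n%n≡m%n x n)
    y+c+1≡c'+c+1 : (y + (c + 1)) % n ≡ (c' + (c + 1)) % n
    y+c+1≡c'+c+1 = begin
      (y + (c + 1)) % n   ≡⟨ cong (_% n) (x∙yz≈y∙xz y c 1) ⟩
      (c + (y + 1)) % n   ≡⟨ %-congˡ-+ (y + 1) c≡x ⟩
      (x + (y + 1)) % n   ≡⟨ cong (_% n) (trans (sym (+-assoc x y 1)) x+y+1≡N) ⟩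
      N % n               ≡⟨ c+c'+1≡N ⟨
      (c + c' + 1) % n    ≡⟨ cong (_% n) (trans (+-assoc c c' 1) (x∙yz≈y∙xz c c' 1)) ⟩
      (c' + (c + 1)) % n  ∎

module SelfConjugateRows (L : ℕ → ℕ) (s : ℕ) (L0≡s : L 0 ≡ s)
                         (L-symmetric : ∀ i j → j < L i → i < L j) where

  L[s]≡0 : L s ≡ 0
  L[s]≡0 = n≤0⇒n≡0 (≮⇒≥ λ 0<Ls → <-irrefl (sym L0≡s) (L-symmetric s 0 0<Ls))

  L≤s : ∀ k → L k ≤ s
  L≤s k = ≮⇒≥ λ s<Lk → n≮0 (subst (k <_) L[s]≡0 (L-symmetric k s s<Lk))

  L-antitone : ∀ k → L (suc k) ≤ L k
  L-antitone k = ≮⇒≥ λ Lk<L1+k →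
    <-irrefl refl (L-symmetric (L k) k (<-trans (n<1+n k) (L-symmetric (suc k) (L k) Lk<L1+k)))

  L-gap : ∀ {k j} → L (suc k) ≤ j → j < L k → L j ≡ suc k
  L-gap {k} {j} L1+k≤j j<Lk =
    ≤-antisym (≮⇒≥ λ 1+k<Lj → <⇒≱ (L-symmetric j (suc k) 1+k<Lj) L1+k≤j) (L-symmetric k j j<Lk)

  B : ℕ → ℕ
  B i = L i + (s ∸ suc i)

  Y : ℕ → ℕ
  Y j = s + j ∸ L j

  B+Y : ∀ {j} → j < s → B j + Y j + 1 ≡ s + s
  B+Y {j} j<s = begin
    L j + u + Y j + 1    ≡⟨ rearrange (L j) u (Y j) ⟩
    L j + Y j + suc u    ≡⟨ cong (_+ suc u) (m+[n∸m]≡n (≤-trans (L≤s j) (m≤m+n s j))) ⟩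
    s + j + suc u        ≡⟨ +-assoc s j (suc u) ⟩
    s + (j + suc u)      ≡⟨ cong (s +_) (trans (+-suc j u) (m+[n∸m]≡n j<s)) ⟩
    s + s                ∎
    where
    u = s ∸ suc j
    rearrange : ∀ l u y → l + u + y + 1 ≡ l + y + suc u
    rearrange = solve-∀

  Y-gap : ∀ {k j} → k < s → L (suc k) ≤ j → j < L k → Y j ≡ j + (s ∸ suc k)
  Y-gap {k} {j} k<s L1+k≤j j<Lk = begin
    s + j ∸ L j                  ≡⟨ cong (s + j ∸_) (L-gap L1+k≤j j<Lk) ⟩
    s + j ∸ suc k                ≡⟨ cong (_∸ suc k) (+-comm s j) ⟩
    j + s ∸ suc k                ≡⟨ +-∸-assoc j k<s ⟩
    j + (s ∸ suc k)              ∎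

  -- The right-hand side sums g over the interval [L k + (s ∸ k), 2s).
  rows-and-columns : (g : ℕ → ℕ) → ∀ k → k ≤ s →
    ∑[ i < k ] g (B i) + ∑[ j < s ∸ L k ] g (Y (L k + j)) ≡ ∑[ x < k + (s ∸ L k) ] g (L k + (s ∸ k) + x)
  rows-and-columns g zero    _   rewrite L0≡s | n∸n≡0 s = refl
  rows-and-columns g (suc k) k<s = begin
    ∑[ i < suc k ] g (B i) + ∑[ j < s ∸ a ] g (Y (a + j))
      ≡⟨ cong₂ _+_ (∑-suc k (λ i → g (B i))) columns ⟩
    (X + g (B k)) + (P + Q)
      ≡⟨ shuffle X (g (B k)) P Q ⟩
    P + (g (B k) + (X + Q))
      ≡⟨ cong (λ z → P + (g (B k) + z)) (rows-and-columns g k (<⇒≤ k<s)) ⟩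
    P + (g (B k) + R)
      ≡⟨ interval ⟨
    ∑[ x < suc k + (s ∸ a) ] g (a + u + x) ∎
    where
    a = L (suc k)
    b = L k
    u = s ∸ suc k
    d = b ∸ a
    a≤b = L-antitone k
    a+d≡b : a + d ≡ b
    a+d≡b = m+[n∸m]≡n a≤b
    s∸a≡d+s∸b : s ∸ a ≡ d + (s ∸ b)
    s∸a≡d+s∸b = trans (cong (_∸ a) (sym (m+[n∸m]≡n (L≤s k)))) (+-∸-comm (s ∸ b) a≤b)
    X = ∑[ i < k ] g (B i)
    P = ∑[ j < d ] g (a + u + j)
    Q = ∑[ j < s ∸ b ] g (Y (b + j))
    R = ∑[ x < k + (s ∸ b) ] g (b + (s ∸ k) + x)
    shuffle : ∀ x y p q → (x + y) + (p + q) ≡ p + (y + (x + q))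
    shuffle = solve-∀

    columns : ∑[ j < s ∸ a ] g (Y (a + j)) ≡ P + Q
    columns = begin
      ∑[ j < s ∸ a ] g (Y (a + j))
        ≡⟨ cong (λ n → ∑[ j < n ] g (Y (a + j))) s∸a≡d+s∸b ⟩
      ∑[ j < d + (s ∸ b) ] g (Y (a + j))
        ≡⟨ ∑-+ d (s ∸ b) _ ⟩
      ∑[ j < d ] g (Y (a + j)) + ∑[ j < s ∸ b ] g (Y (a + (d + j)))
        ≡⟨ cong₂ _+_ (∑-cong d gap) (∑-cong (s ∸ b) shift) ⟩
      P + Q ∎
      where
      gap : ∀ j → j < d → g (Y (a + j)) ≡ g (a + u + j)
      gap j j<d = cong g (trans (Y-gap k<s (m≤m+n a j) (subst (a + j <_) a+d≡b (+-monoʳ-< a j<d)))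
                                (xy∙z≈xz∙y a j u))
      shift : ∀ j → j < s ∸ b → g (Y (a + (d + j))) ≡ g (Y (b + j))
      shift j _ = cong (λ z → g (Y z)) (trans (sym (+-assoc a d j)) (cong (_+ j) a+d≡b))

    interval : ∑[ x < suc k + (s ∸ a) ] g (a + u + x) ≡ P + (g (B k) + R)
    interval = begin
      ∑[ x < suc k + (s ∸ a) ] g (a + u + x)
        ≡⟨ cong (λ n → ∑[ x < n ] g (a + u + x)) lengths ⟩
      ∑[ x < d + suc (k + (s ∸ b)) ] g (a + u + x)
        ≡⟨ ∑-+ d _ _ ⟩
      P + (g (a + u + (d + 0)) + ∑[ x < k + (s ∸ b) ] g (a + u + (d + suc x)))
        ≡⟨ cong (P +_) (cong₂ _+_ (cong g Bk) (∑-cong (k + (s ∸ b)) (λ x _ → cong g (later x)))) ⟩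
      P + (g (B k) + R) ∎
      where
      lengths : suc k + (s ∸ a) ≡ d + suc (k + (s ∸ b))
      lengths = trans (cong (suc k +_) s∸a≡d+s∸b) (move k d (s ∸ b))
        where
        move : ∀ k d w → suc k + (d + w) ≡ d + suc (k + w)
        move = solve-∀
      Bk : a + u + (d + 0) ≡ B k
      Bk = trans (move a u d) (cong (_+ u) a+d≡b)
        where
        move : ∀ a u d → a + u + (d + 0) ≡ a + d + u
        move = solve-∀
      later : ∀ x → a + u + (d + suc x) ≡ b + (s ∸ k) + x
      later x = trans (move a u d x) (cong₂ (λ l r → l + r + x) a+d≡b (sym (+-∸-assoc 1 k<s)))
        where
        move : ∀ a u d x → a + u + (d + suc x) ≡ a + d + suc u + x
        move = solve-∀

  rows+columns : (g : ℕ → ℕ) → ∑[ i < s ] g (B i) + ∑[ j < s ] g (Y j) ≡ ∑[ x < s + s ] g x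
  rows+columns g with rows-and-columns g s ≤-refl
  ... | filled rewrite L[s]≡0 | n∸n≡0 s = filled

  ∑-B-complementary : ∀ {t} .{{_ : NonZero t}} {c c'} →
    c < t → c' < t → (c + c' + 1) % t ≡ (s + s) % t →
    ∑[ i < s ] indicator (B i % t ≟ c) + ∑[ i < s ] indicator (B i % t ≟ c') ≡ ∑[ x < s + s ] indicator (x % t ≟ c)
  ∑-B-complementary {t} {c} {c'} c<t c'<t c+c'+1≡2s = begin
    ∑[ i < s ] indicator (B i % t ≟ c) + ∑[ i < s ] indicator (B i % t ≟ c')
      ≡⟨ cong (∑[ i < s ] indicator (B i % t ≟ c) +_) (∑-cong s reflect) ⟩
    ∑[ i < s ] indicator (B i % t ≟ c) + ∑[ j < s ] indicator (Y j % t ≟ c)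
      ≡⟨ rows+columns (λ x → indicator (x % t ≟ c)) ⟩
    ∑[ x < s + s ] indicator (x % t ≟ c) ∎
    where
    reflect : ∀ j → j < s → indicator (B j % t ≟ c') ≡ indicator (Y j % t ≟ c)
    reflect j j<s = indicator-cong
      (mk⇔ (residue-reflect {x = B j} {y = Y j} (B+Y j<s) c'+c+1≡2s c<t)
           (residue-reflect {x = Y j} {y = B j} (trans (cong (_+ 1) (+-comm (Y j) (B j))) (B+Y j<s)) c+c'+1≡2s c'<t))
      (B j % t ≟ c') (Y j % t ≟ c)
      where
      c'+c+1≡2s : (c' + c + 1) % t ≡ (s + s) % t
      c'+c+1≡2s = trans (cong (λ z → (z + 1) % t) (+-comm c' c)) c+c'+1≡2s


length-filter-∷ : ∀ {p} {P : Pred ℕ p} (P? : Decidable P) x xs →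
                  length (filter P? (x ∷ xs)) ≡ indicator (P? x) + length (filter P? xs)
length-filter-∷ P? x xs with does (P? x)
... | true  = refl
... | false = refl

length-filter-applyUpTo : ∀ {p} {P : Pred ℕ p} (P? : Decidable P) (f : ℕ → ℕ) n →
                          length (filter P? (applyUpTo f n)) ≡ ∑[ k < n ] indicator (P? (f k))
length-filter-applyUpTo P? f zero    = refl
length-filter-applyUpTo P? f (suc n) = trans (length-filter-∷ P? (f 0) _)
  (cong (indicator (P? (f 0)) +_) (length-filter-applyUpTo P? (λ k → f (suc k)) n))

part-applyUpTo : ∀ (f : ℕ → ℕ) {n j} → j < n → part (applyUpTo f n) j ≡ f j
part-applyUpTo f {suc n} {zero}  _         = refl
part-applyUpTo f {suc n} {suc j} (s≤s j<n) = part-applyUpTo (λ k → f (suc k)) j<n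

columnLength : List ℕ → ℕ → ℕ
columnLength la j = length (filter (λ x → suc j ≤? x) la)

Decreasing-tail : ∀ {x} xs → Decreasing (x ∷ xs) → Decreasing xs
Decreasing-tail []       _       = _
Decreasing-tail (y ∷ ys) (_ , d) = d

part≤head : ∀ x xs → Decreasing (x ∷ xs) → ∀ i → part (x ∷ xs) i ≤ x
part≤head x []       _         zero    = ≤-refl
part≤head x []       _         (suc i) = z≤n
part≤head x (y ∷ ys) _         zero    = ≤-refl
part≤head x (y ∷ ys) (y≤x , d) (suc i) = ≤-trans (part≤head y ys d i) y≤x

<columnLength⇔<part : ∀ la → Decreasing la → ∀ i j → i < columnLength la j ⇔ j < part la i
<columnLength⇔<part []       _ i j = mk⇔ (λ ()) (λ ())
<columnLength⇔<part (x ∷ xs) d i j with suc j ≤? x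
... | yes j<x rewrite filter-accept (λ x → suc j ≤? x) {x} {xs} j<x = step i
  where
  step : ∀ i → i < suc (columnLength xs j) ⇔ j < part (x ∷ xs) i
  step zero    = mk⇔ (λ _ → j<x) (λ _ → z<s)
  step (suc i) = mk⇔ (λ i<l → to (s<s⁻¹ i<l)) (λ j<p → s<s (from j<p))
    where open Equivalence (<columnLength⇔<part xs (Decreasing-tail xs d) i j)
... | no j≮x rewrite filter-reject (λ x → suc j ≤? x) {x} {xs} j≮x =
  mk⇔ (λ i<l → contradiction (≤-trans (to i<l) (part≤head x xs d (suc i))) j≮x)
      (λ j<p → contradiction (≤-trans j<p (part≤head x xs d i)) j≮x)
  where open Equivalence (<columnLength⇔<part xs (Decreasing-tail xs d) i j)

module _ {la : List ℕ} (isPartition : IsPartition la) (selfConjugate : SelfConjugate la) where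

  part[0]≡length : part la 0 ≡ length la
  part[0]≡length = begin
    part la 0         ≡⟨ trans (length-map _ (upTo (part la 0))) (length-upTo (part la 0)) ⟨
    length (conj la)  ≡⟨ cong length selfConjugate ⟩
    length la         ∎

  part-symmetric : ∀ i j → j < part la i → i < part la j
  part-symmetric i j j<λᵢ = subst (i <_) λ'ⱼ≡λⱼ (from j<λᵢ)
    where
    open Equivalence (<columnLength⇔<part la (proj₁ isPartition) i j) using (from)
    j<λ₀ : j < part la 0
    j<λ₀ = Equivalence.to (<columnLength⇔<part la (proj₁ isPartition) 0 j) (≤-<-trans z≤n (from j<λᵢ))
    λ'ⱼ≡λⱼ : columnLength la j ≡ part la j
    λ'ⱼ≡λⱼ = trans (sym (part-applyUpTo (columnLength la) j<λ₀))
                   (cong (λ μ → part μ j) (trans (sym (map-upTo (columnLength la) (part la 0))) selfConjugate))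

length-structureNumbers : ∀ la → length (structureNumbers la) ≡ length la
length-structureNumbers la = trans (length-map _ (upTo (length la))) (length-upTo (length la))

module _ (t : ℕ) .{{_ : NonZero t}} where

  ∑-residue-window : ∀ {c} → c < t → ∑[ x < t ] indicator (x % t ≟ c) ≡ 1
  ∑-residue-window {c} c<t =
    trans (∑-cong t (λ x x<t → cong (λ r → indicator (r ≟ c)) (m<n⇒m%n≡m x<t))) (∑-indicator-≟ c<t)

  ∑-residue-counts : ∀ xs → ∑[ c < t ] length (filter (λ x → x % t ≟ c) xs) ≡ length xs
  ∑-residue-counts []       = trans (∑-const t 0) (*-zeroʳ t)
  ∑-residue-counts (y ∷ ys) = begin
    ∑[ c < t ] length (filter (λ x → x % t ≟ c) (y ∷ ys))
      ≡⟨ ∑-cong t (λ c _ → length-filter-∷ (λ x → x % t ≟ c) y ys) ⟩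
    ∑[ c < t ] (indicator (y % t ≟ c) + length (filter (λ x → x % t ≟ c) ys))
      ≡⟨ ∑-distrib-+ t _ _ ⟩
    ∑[ c < t ] indicator (y % t ≟ c) + ∑[ c < t ] length (filter (λ x → x % t ≟ c) ys)
      ≡⟨ cong₂ _+_ one (∑-residue-counts ys) ⟩
    suc (length ys) ∎
    where
    one : ∑[ c < t ] indicator (y % t ≟ c) ≡ 1
    one = trans (∑-cong t (λ c _ → indicator-cong (mk⇔ sym sym) (y % t ≟ c) (c ≟ y % t)))
                (∑-indicator-≟ (m%n<n y t))

  ∑-abacusCount : ∀ la → ∑[ c < t ] abacusCount t la c ≡ length la
  ∑-abacusCount la = trans (∑-residue-counts (structureNumbers la)) (length-structureNumbers la)

  abacusCount≡∑ : ∀ la c →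
    abacusCount t la c ≡ ∑[ i < length la ] indicator ((part la i + (length la ∸ suc i)) % t ≟ c)
  abacusCount≡∑ la c = trans (cong (λ xs → length (filter (λ x → x % t ≟ c) xs)) (map-upTo _ (length la)))
                             (length-filter-applyUpTo (λ x → x % t ≟ c) _ (length la))

abacusCount-complementary : ∀ t .{{_ : NonZero t}} {la} → IsPartition la → SelfConjugate la →
  ∀ {n q c c'} → length la ≡ n * t + q → c < t → c' < t → (c + c' + 1) % t ≡ (q + q) % t →
  abacusCount t la c + abacusCount t la c' ≡ 2 * n + ∑[ x < q + q ] indicator (x % t ≟ c)
abacusCount-complementary t {la} isPartition selfConjugate {n} {q} {c} {c'} s≡nt+q c<t c'<t c+c'+1≡2q = begin
  abacusCount t la c + abacusCount t la c'
    ≡⟨ cong₂ _+_ (abacusCount≡∑ t la c) (abacusCount≡∑ t la c') ⟩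
  ∑[ i < s ] indicator (B i % t ≟ c) + ∑[ i < s ] indicator (B i % t ≟ c')
    ≡⟨ ∑-B-complementary c<t c'<t (trans c+c'+1≡2q (sym 2s≡2q)) ⟩
  ∑[ x < s + s ] χ x
    ≡⟨ cong (λ m → ∑ m χ) 2s≡2nt+2q ⟩
  ∑[ x < 2 * n * t + (q + q) ] χ x
    ≡⟨ ∑-periodic t (2 * n) (q + q) χ (λ x → cong (λ r → indicator (r ≟ c)) (%-remove-+ˡ x ∣-refl)) ⟩
  2 * n * ∑ t χ + ∑ (q + q) χ
    ≡⟨ cong (λ w → 2 * n * w + ∑ (q + q) χ) (∑-residue-window t c<t) ⟩
  2 * n * 1 + ∑ (q + q) χ
    ≡⟨ cong (_+ ∑ (q + q) χ) (*-identityʳ (2 * n)) ⟩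
  2 * n + ∑[ x < q + q ] indicator (x % t ≟ c) ∎
  where
  s = length la
  open SelfConjugateRows (part la) s (part[0]≡length isPartition selfConjugate)
                         (part-symmetric isPartition selfConjugate)
  χ : ℕ → ℕ
  χ x = indicator (x % t ≟ c)
  2s≡2nt+2q : s + s ≡ 2 * n * t + (q + q)
  2s≡2nt+2q = trans (cong₂ _+_ s≡nt+q s≡nt+q) (double n t q)
    where
    double : ∀ n t q → (n * t + q) + (n * t + q) ≡ 2 * n * t + (q + q)
    double = solve-∀
  2s≡2q : (s + s) % t ≡ (q + q) % t
  2s≡2q = trans (cong (_% t) 2s≡2nt+2q) (%-remove-+ˡ (q + q) (n∣m*n (2 * n)))

lemma3p2 : (la : List ℕ) → IsPartition la → SelfConjugate la → IsCore 6 la →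
    (a b c d e : ℕ) →
    abacusCount 6 la 0 ≡ 0 → abacusCount 6 la 1 ≡ a → abacusCount 6 la 2 ≡ b →
    abacusCount 6 la 3 ≡ c → abacusCount 6 la 4 ≡ d → abacusCount 6 la 5 ≡ e →
    (r : ℕ) →
    (a + b + c + d + e ≡ 6 * r → (e ≡ 2 * r) × (a + d ≡ 2 * r) × (b + c ≡ 2 * r)) ×
    (a + b + c + d + e ≡ 6 * r + 1 → (a ≡ 2 * r + 1) × (b + e ≡ 2 * r) × (c + d ≡ 2 * r)) ×
    (a + b + c + d + e ≡ 6 * r + 2 → (a + b ≡ 2 * r + 1) × (c ≡ 2 * r + 1) × (d + e ≡ 2 * r)) ×
    (a + b + c + d + e ≡ 6 * r + 3 → (b + c ≡ 2 * r + 1) × (a + d ≡ 2 * r + 1) × (e ≡ 2 * r + 1)) ×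
    (a + b + c + d + e ≡ 6 * r + 4 → (c + d ≡ 2 * r + 1) × (b + e ≡ 2 * r + 1) × (a ≡ 2 * r + 2)) ×
    (a + b + c + d + e ≡ 6 * r + 5 → (d + e ≡ 2 * r + 1) × (a + b ≡ 2 * r + 2) × (c ≡ 2 * r + 2))
lemma3p2 la isPartition selfConjugate _ _ _ _ _ _ m₀≡0 refl refl refl refl refl r =
    (λ eq → let eq′ = trans eq (sym (+-identityʳ (6 * r))) in
      drop+0 (single {0} eq′ (# 5) refl) ,
      drop+0 (pair {0} eq′ (# 1) (# 4) refl) ,
      drop+0 (pair {0} eq′ (# 2) (# 3) refl))
  , (λ eq → single {1} eq (# 1) refl , drop+0 (pair {1} eq (# 2) (# 5) refl) , drop+0 (pair {1} eq (# 3) (# 4) refl))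
  , (λ eq → pair {2} eq (# 1) (# 2) refl , single {2} eq (# 3) refl , drop+0 (pair {2} eq (# 4) (# 5) refl))
  , (λ eq → pair {3} eq (# 2) (# 3) refl , pair {3} eq (# 1) (# 4) refl , single {3} eq (# 5) refl)
  , (λ eq → pair {4} eq (# 3) (# 4) refl , pair {4} eq (# 2) (# 5) refl , single {4} eq (# 1) refl)
  , (λ eq → pair {5} eq (# 4) (# 5) refl , pair {5} eq (# 1) (# 2) refl , single {5} eq (# 3) refl)
  where
  m : ℕ → ℕ
  m = abacusCount 6 la

  total : m 1 + m 2 + m 3 + m 4 + m 5 ≡ length la
  total = begin
    m 1 + m 2 + m 3 + m 4 + m 5  ≡⟨ unfold (m 1) (m 2) (m 3) (m 4) (m 5) ⟩
    0 + rest                     ≡⟨ cong (_+ rest) m₀≡0 ⟨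
    ∑[ c < 6 ] m c               ≡⟨ ∑-abacusCount 6 la ⟩
    length la                    ∎
    where
    rest = m 1 + (m 2 + (m 3 + (m 4 + (m 5 + 0))))
    unfold : ∀ a b c d e → a + b + c + d + e ≡ 0 + (a + (b + (c + (d + (e + 0)))))
    unfold = solve-∀

  pair : ∀ {q} → m 1 + m 2 + m 3 + m 4 + m 5 ≡ 6 * r + q →
         (i j : Fin 6) → (toℕ i + toℕ j + 1) % 6 ≡ (q + q) % 6 →
         m (toℕ i) + m (toℕ j) ≡ 2 * r + ∑[ x < q + q ] indicator (x % 6 ≟ toℕ i)
  pair {q} eq i j = abacusCount-complementary 6 isPartition selfConjugate {r} {q}
    (trans (sym total) (trans eq (cong (_+ q) (*-comm 6 r)))) (toℕ<n i) (toℕ<n j)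

  single : ∀ {q} → m 1 + m 2 + m 3 + m 4 + m 5 ≡ 6 * r + q →
           (j : Fin 6) → (toℕ j + 1) % 6 ≡ (q + q) % 6 →
           m (toℕ j) ≡ 2 * r + ∑[ x < q + q ] indicator (x % 6 ≟ 0)
  single eq j cond = trans (cong (_+ m (toℕ j)) (sym m₀≡0)) (pair eq (# 0) j cond)

  drop+0 : ∀ {x} → x ≡ 2 * r + 0 → x ≡ 2 * r
  drop+0 eq = trans eq (+-identityʳ (2 * r))
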